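{- Let $\Gamma$ be a bipartite distance-regular graph with diameter $3$ and let $C$ be a set of vertices of $\Gamma$. Then $C$ is a perfect $1$-code of $\Gamma$ if and only if $\Gamma$ is a complete bipartite graph $K_{m,m}$ minus a perfect matching (for some $m$) and $C$ consists of exactly two vertices at distance $3$, lying in different parts of the bipartition.
   Context: A connected graph of diameter $d$ is distance-regular if for any two vertices $x,y$ at distance $i$ the number of neighbours of $x$ at distance $i+1$ (resp. $i-1$) from $y$ depends only on $i$. A perfect $1$-code is a vertex subset $C$ such that the closed neighbourhoods of the vertices of $C$ partition the vertex set. -}

module Defs where

open import Data.Nat using (ℕ; zero; suc)
open import Data.Bool using (Bool; true; false; _∧_; _∨_; not; if_then_else_)
open import Data.Fin using (Fin; _≟_)
open import Data.List using (List; length; filter)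
open import Data.Bool.ListAction using (any)
open import Data.List using () renaming (map to lmap)
open import Data.Fin.Base using () renaming (toℕ to toℕ)
open import Data.List.Base using (allFin)
open import Data.Product using (Σ; ∃; _×_; _,_; proj₁; proj₂)
open import Data.Sum using (_⊎_)
open import Relation.Binary.PropositionalEquality using (_≡_; _≢_)
open import Relation.Nullary.Decidable using (⌊_⌋)
open import Function.Bundles using (_↔_; _⇔_; Inverse)

record Graph : Set where
  field
    n     : ℕ
    adj   : Fin n → Fin n → Bool
    sym   : ∀ x y → adj x y ≡ adj y x
    irrefl : ∀ x → adj x x ≡ false
open Graph public

module _ (G : Graph) where
  private
    V = Fin (n G)

  count : (V → Bool) → ℕ
  count p = length (filter (λ z → p z Data.Bool.≟ true) (allFin (n G)))

  -- reach k x y = true  iff  there is a walk of length ≤ k from x to y,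
  -- i.e. iff d(x,y) ≤ k
  reach : ℕ → V → V → Bool
  reach zero x y = ⌊ x ≟ y ⌋
  reach (suc k) x y = reach k x y ∨ any (λ z → adj G x z ∧ reach k z y) (allFin (n G))

  atDist : ℕ → V → V → Bool
  atDist zero x y = reach zero x y
  atDist (suc k) x y = reach (suc k) x y ∧ not (reach k x y)

  HasDiameter : ℕ → Set
  HasDiameter d = (∀ x y → reach d x y ≡ true) × (Σ V λ x → Σ V λ y → atDist d x y ≡ true)

  bNum : ℕ → V → V → ℕ
  bNum i x y = count (λ z → adj G x z ∧ atDist (suc i) z y)

  cNum : ℕ → V → V → ℕ
  cNum zero x y = 0
  cNum (suc i) x y = count (λ z → adj G x z ∧ atDist i z y)

  -- Distance-regular: connected, and b_i(x,y), c_i(x,y) depend only on i = d(x,y).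
  -- (connectedness is supplied separately by HasDiameter)
  DistanceRegular : Set
  DistanceRegular = ∀ i x y x′ y′ → atDist i x y ≡ true → atDist i x′ y′ ≡ true →
                    (bNum i x y ≡ bNum i x′ y′) × (cNum i x y ≡ cNum i x′ y′)

  Bipartite : Set
  Bipartite = Σ (V → Bool) λ col → ∀ x y → adj G x y ≡ true → col x ≢ col y

  inClosedNbr : V → V → Set
  inClosedNbr c v = (c ≡ v) ⊎ (adj G c v ≡ true)

  Perfect1Code : (V → Bool) → Set
  Perfect1Code C =
    ∀ v → Σ V (λ c → C c ≡ true × inClosedNbr c v)
        × (∀ c c′ → C c ≡ true → C c′ ≡ true → inClosedNbr c v → inClosedNbr c′ v → c ≡ c′)

-- Γ is isomorphic to K_{m,m} minus a perfect matching, via f : V ↔ Fin m × Bool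
-- (second component = side of the bipartition); (i,s) ~ (j,t) iff s ≠ t and i ≠ j.
IsKmmMinusMatching : (G : Graph) (m : ℕ) → (Fin (n G) ↔ (Fin m × Bool)) → Set
IsKmmMinusMatching G m f =
  ∀ x y → (adj G x y ≡ true) ⇔ ((proj₂ (to x) ≢ proj₂ (to y)) × (proj₁ (to x) ≢ proj₁ (to y)))
  where open Inverse f

{-# OPTIONS --safe #-}

-- In a bipartite graph of diameter 3 two vertices of the same colour have a common
-- closed neighbour, so a perfect 1-code has at most one codeword of each colour.
-- Covering the two ends of a path of length 3 therefore forces exactly two codewords
-- u and v, of different colours and at distance 3, and every other vertex of u's colour
-- class must be adjacent to v (and symmetrically). Since Γ is regular, a vertex x ≠ u of
-- u's colour, whose neighbours other than v are all neighbours of u, misses exactly one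
-- neighbour of u. Thus every vertex has a unique non-neighbour of the other colour, and
-- matching each vertex with it identifies Γ with K_{m,m} minus a perfect matching.
-- Conversely, the closed neighbourhoods of two matched vertices are disjoint and cover
-- K_{m,m} minus the matching.
module Submission where

open import Defs hiding (sym)
open import Data.Nat using (ℕ; zero; suc; _+_)
open import Data.Nat.Properties using (+-suc; suc-injective; +-cancelˡ-≡; +-comm)
open import Data.Bool using (Bool; true; false; _∧_; _∨_; not; T; if_then_else_)
open import Data.Bool.Properties
  using (T-≡; T-irrelevant; ∧-zeroʳ; ∨-zeroʳ; ¬-not) renaming (_≟_ to _≟ᵇ_)
open import Data.Bool.ListAction using (any)
open import Data.Fin using (Fin; zero; suc; _≟_)
open import Data.Fin.Properties using () renaming (suc-injective to Fin-suc-injective)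
open import Data.List using (_∷_; length; filter; tabulate; allFin)
open import Data.List.Membership.Propositional using (_∈_)
open import Data.List.Membership.Propositional.Properties using (∈-allFin)
open import Data.List.Relation.Unary.Any using (here; there)
open import Data.Product using (Σ; ∃-syntax; ∃!; _×_; _,_; proj₁; proj₂)
open import Data.Product as Σ using ()
open import Data.Product.Function.NonDependent.Propositional using (_×-↔_)
open import Data.Sum using (_⊎_; inj₁; inj₂; [_,_])
open import Data.Sum.Function.Propositional using (_⊎-↔_)
open import Data.Unit using (⊤)
open import Function using (_∘_; id)
open import Function.Bundles using (_↔_; _⇔_; mk↔ₛ′; mk⇔; Inverse; Injection; Equivalence)
open import Function.Construct.Composition using (_↔-∘_)
open import Function.Construct.Identity using (↔-id)
open import Function.Properties.Inverse using (↔⇒↣)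
open import Relation.Nullary using (yes; no; ¬_; contradiction)
open import Relation.Nullary.Decidable using (⌊_⌋; ⌊⌋-map′)
open import Relation.Binary.PropositionalEquality
  using (_≡_; _≢_; refl; sym; trans; cong; cong₂; subst; ≢-sym; module ≡-Reasoning)

≢-≢⇒≡ : {a b c : Bool} → a ≢ b → b ≢ c → a ≡ c
≢-≢⇒≡ a≢b b≢c = trans (¬-not a≢b) (sym (¬-not (λ c≡b → b≢c (sym c≡b))))

∧≡true⇒ : ∀ {a b} → a ∧ b ≡ true → a ≡ true × b ≡ true
∧≡true⇒ {true} {true} refl = refl , refl

⌊≟⌋≡false : ∀ {k} {x y : Fin k} → x ≢ y → ⌊ x ≟ y ⌋ ≡ false
⌊≟⌋≡false {x = x} {y} x≢y with x ≟ y
... | yes x≡y = contradiction x≡y x≢y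
... | no  _   = refl

not⌊≟⌋≡true⇒≢ : ∀ {k} {x y : Fin k} → not ⌊ x ≟ y ⌋ ≡ true → x ≢ y
not⌊≟⌋≡true⇒≢ {x = x} {y} _ x≡y with x ≟ y
... | no x≢y = x≢y x≡y

any⇒∃ : ∀ {A : Set} (p : A → Bool) xs → any p xs ≡ true → ∃[ x ] p x ≡ true
any⇒∃ p (x ∷ xs) any≡true with p x in px
... | true  = x , px
... | false = any⇒∃ p xs any≡true

∃⇒any : ∀ {A : Set} (p : A → Bool) {xs x} → x ∈ xs → p x ≡ true → any p xs ≡ true
∃⇒any p {x ∷ _} (here refl) px rewrite px = refl
∃⇒any p {y ∷ _} (there x∈xs) px with p y
... | true  = refl
... | false = ∃⇒any p x∈xs px

∃!-⇔ : ∀ {A : Set} {P Q : A → Set} → (∀ x → P x ⇔ Q x) → ∃! _≡_ P → ∃! _≡_ Q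
∃!-⇔ P⇔Q (x , Px , unique) =
  x , Equivalence.to (P⇔Q x) Px , λ {y} Qy → unique (Equivalence.from (P⇔Q y) Qy)

Σ-T-≡ : ∀ {V : Set} {P : V → Bool} {s t : Σ V (T ∘ P)} → proj₁ s ≡ proj₁ t → s ≡ t
Σ-T-≡ {s = x , p} {.x , q} refl = cong (x ,_) (T-irrelevant p q)

countᶠ : ∀ {k} → (Fin k → Bool) → ℕ
countᶠ {zero}  p = 0
countᶠ {suc k} p = if p zero then suc (countᶠ (p ∘ suc)) else countᶠ (p ∘ suc)

count≡countᶠ : ∀ G (p : Fin (n G) → Bool) → count G p ≡ countᶠ p
count≡countᶠ G p = filter-tabulate (n G) id
  where
  filter-tabulate : ∀ k (g : Fin k → Fin (n G)) →
    length (filter (λ z → p z Data.Bool.≟ true) (tabulate g)) ≡ countᶠ (p ∘ g)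
  filter-tabulate zero    g = refl
  filter-tabulate (suc k) g with p (g zero)
  ... | true  = cong suc (filter-tabulate k (g ∘ suc))
  ... | false = filter-tabulate k (g ∘ suc)

countᶠ-cong : ∀ {k} {p q : Fin k → Bool} → (∀ i → p i ≡ q i) → countᶠ p ≡ countᶠ q
countᶠ-cong {zero}          p≗q = refl
countᶠ-cong {suc k} {p} {q} p≗q with p zero | q zero | p≗q zero
... | true  | true  | refl = cong suc (countᶠ-cong (p≗q ∘ suc))
... | false | false | refl = countᶠ-cong (p≗q ∘ suc)

countᶠ-split : ∀ {k} (p q : Fin k → Bool) →
  countᶠ p ≡ countᶠ (λ i → p i ∧ q i) + countᶠ (λ i → p i ∧ not (q i))
countᶠ-split {zero}  p q = refl
countᶠ-split {suc k} p q with p zero | q zero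
... | true  | true  = cong suc (countᶠ-split (p ∘ suc) (q ∘ suc))
... | true  | false = trans (cong suc (countᶠ-split (p ∘ suc) (q ∘ suc))) (sym (+-suc _ _))
... | false | _     = countᶠ-split (p ∘ suc) (q ∘ suc)

none⇒countᶠ≡0 : ∀ {k} (p : Fin k → Bool) → (∀ i → p i ≡ false) → countᶠ p ≡ 0
none⇒countᶠ≡0 {zero}  p none = refl
none⇒countᶠ≡0 {suc k} p none with p zero | none zero
... | false | refl = none⇒countᶠ≡0 (p ∘ suc) (none ∘ suc)

countᶠ-singleton : ∀ {k} (v : Fin k) → countᶠ (λ i → ⌊ i ≟ v ⌋) ≡ 1
countᶠ-singleton {suc k} zero    = cong suc (none⇒countᶠ≡0 {k} _ (λ _ → refl))
countᶠ-singleton {suc k} (suc v) =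
  trans (countᶠ-cong (λ i → ⌊⌋-map′ (cong suc) Fin-suc-injective (i ≟ v)))
        (countᶠ-singleton v)

countᶠ-remove : ∀ {k} (p : Fin k → Bool) {v} → p v ≡ true →
  countᶠ p ≡ suc (countᶠ (λ i → p i ∧ not ⌊ i ≟ v ⌋))
countᶠ-remove p {v} pv = trans (countᶠ-split p (λ i → ⌊ i ≟ v ⌋))
  (cong (_+ countᶠ (λ i → p i ∧ not ⌊ i ≟ v ⌋))
        (trans (countᶠ-cong p∧≡v) (countᶠ-singleton v)))
  where
  p∧≡v : ∀ i → p i ∧ ⌊ i ≟ v ⌋ ≡ ⌊ i ≟ v ⌋
  p∧≡v i with i ≟ v
  ... | yes refl = cong (_∧ true) pv
  ... | no  _    = ∧-zeroʳ (p i)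

countᶠ≡0⇒none : ∀ {k} (p : Fin k → Bool) → countᶠ p ≡ 0 → ∀ i → p i ≡ false
countᶠ≡0⇒none {suc k} p #p≡0 i with p zero in p0
countᶠ≡0⇒none {suc k} p #p≡0 zero    | false = p0
countᶠ≡0⇒none {suc k} p #p≡0 (suc i) | false = countᶠ≡0⇒none (p ∘ suc) #p≡0 i

countᶠ≡1⇒∃! : ∀ {k} (p : Fin k → Bool) → countᶠ p ≡ 1 → ∃! _≡_ (λ i → p i ≡ true)
countᶠ≡1⇒∃! {suc k} p #p≡1 with p zero in p0
... | true = zero , p0 , only-zero
  where
  only-zero : ∀ {j} → p j ≡ true → zero ≡ j
  only-zero {zero}  _  = refl
  only-zero {suc j} pj
    with () ← trans (sym pj) (countᶠ≡0⇒none (p ∘ suc) (suc-injective #p≡1) j)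
... | false with countᶠ≡1⇒∃! (p ∘ suc) #p≡1
...   | i , pi , unique = suc i , pi , only-suc-i
  where
  only-suc-i : ∀ {j} → p j ≡ true → suc i ≡ j
  only-suc-i {zero}  pz with () ← trans (sym pz) p0
  only-suc-i {suc j} pj = cong suc (unique pj)

countᶠ-⊆-suc⇒∃! : ∀ {k} (p q : Fin k → Bool) → (∀ i → p i ≡ true → q i ≡ true) →
  countᶠ q ≡ suc (countᶠ p) → ∃! _≡_ (λ i → q i ∧ not (p i) ≡ true)
countᶠ-⊆-suc⇒∃! p q p⊆q #q≡1+#p = countᶠ≡1⇒∃! q∖p (+-cancelˡ-≡ (countᶠ p) _ _ (begin
  countᶠ p + countᶠ q∖p                      ≡⟨ cong (_+ countᶠ q∖p) (countᶠ-cong q∧p≡p) ⟨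
  countᶠ (λ i → q i ∧ p i) + countᶠ q∖p      ≡⟨ countᶠ-split q p ⟨
  countᶠ q                                   ≡⟨ #q≡1+#p ⟩
  suc (countᶠ p)                             ≡⟨ +-comm 1 (countᶠ p) ⟩
  countᶠ p + 1                               ∎))
  where
  open ≡-Reasoning
  q∖p : _ → Bool
  q∖p i = q i ∧ not (p i)
  q∧p≡p : ∀ i → q i ∧ p i ≡ p i
  q∧p≡p i with p i in pi
  ... | true  = cong (_∧ true) (p⊆q i pi)
  ... | false = ∧-zeroʳ (q i)

⊎↔Fin-if : ∀ b c → (T b ⊎ Fin c) ↔ Fin (if b then suc c else c)
⊎↔Fin-if true  c = mk↔ₛ′ [ (λ _ → zero) , suc ] from (λ { zero → refl ; (suc i) → refl })
                          (λ { (inj₁ _) → refl ; (inj₂ i) → refl })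
  where
  from : Fin (suc c) → ⊤ ⊎ Fin c
  from zero    = inj₁ _
  from (suc i) = inj₂ i
⊎↔Fin-if false c =
  mk↔ₛ′ [ (λ ()) , id ] inj₂ (λ _ → refl) (λ { (inj₁ ()) ; (inj₂ i) → refl })

Σ-Fin-suc↔⊎ : ∀ {k} (P : Fin (suc k) → Set) →
  Σ (Fin (suc k)) P ↔ (P zero ⊎ Σ (Fin k) (P ∘ suc))
Σ-Fin-suc↔⊎ P = mk↔ₛ′ to [ (zero ,_) , Σ.map suc id ]
  (λ { (inj₁ _) → refl ; (inj₂ _) → refl }) (λ { (zero , _) → refl ; (suc _ , _) → refl })
  where
  to : Σ (Fin _) P → P zero ⊎ Σ (Fin _) (P ∘ suc)
  to (zero  , x) = inj₁ x
  to (suc i , x) = inj₂ (i , x)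

enumerate : ∀ {k} (p : Fin k → Bool) → Σ (Fin k) (T ∘ p) ↔ Fin (countᶠ p)
enumerate {zero}  p = mk↔ₛ′ (λ ()) (λ ()) (λ ()) (λ ())
enumerate {suc k} p =
  ⊎↔Fin-if (p zero) _ ↔-∘ ((↔-id _ ⊎-↔ enumerate (p ∘ suc)) ↔-∘ Σ-Fin-suc↔⊎ (T ∘ p))

module _ {V : Set} (col : V → Bool) (σ : V → V)
         (σ-involutive : ∀ x → σ (σ x) ≡ x) (col-σ : ∀ x → col (σ x) ≡ not (col x)) where

  representative : V → Σ V (T ∘ col)
  representative x = (if col x then x else σ x) , T-col x
    where
    T-col : ∀ x → T (col (if col x then x else σ x))
    T-col x with col x in cx
    ... | true  = Equivalence.from T-≡ cx
    ... | false = Equivalence.from T-≡ (trans (col-σ x) (cong not cx))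

  representative-true : ∀ {x} → col x ≡ true → proj₁ (representative x) ≡ x
  representative-true {x} cx = cong (λ b → if b then x else σ x) cx

  representative-false : ∀ {x} → col x ≡ false → proj₁ (representative x) ≡ σ x
  representative-false {x} cx = cong (λ b → if b then x else σ x) cx

  representative-σ : ∀ x → representative (σ x) ≡ representative x
  representative-σ x = Σ-T-≡ (by-colour (col x) refl)
    where
    by-colour : ∀ b → col x ≡ b → proj₁ (representative (σ x)) ≡ proj₁ (representative x)
    by-colour true  cx = trans (representative-false (trans (col-σ x) (cong not cx)))
                               (trans (σ-involutive x) (sym (representative-true cx)))
    by-colour false cx = trans (representative-true (trans (col-σ x) (cong not cx)))
                               (sym (representative-false cx))

  ↔representative×Bool : V ↔ (Σ V (T ∘ col) × Bool)
  ↔representative×Bool = mk↔ₛ′ to from to-from from-to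
    where
    to : V → Σ V (T ∘ col) × Bool
    to x = representative x , col x

    from : Σ V (T ∘ col) × Bool → V
    from ((r , _) , b) = if b then r else σ r

    to-from : ∀ y → to (from y) ≡ y
    to-from ((r , cr) , true)  = cong₂ _,_ (Σ-T-≡ (representative-true r≡true)) r≡true
      where r≡true = Equivalence.to T-≡ cr
    to-from ((r , cr) , false) =
      cong₂ _,_ (trans (representative-σ r) (Σ-T-≡ (representative-true r≡true)))
                (trans (col-σ r) (cong not r≡true))
      where r≡true = Equivalence.to T-≡ cr

    from-to : ∀ x → from (to x) ≡ x
    from-to x with col x
    ... | true  = refl
    ... | false = σ-involutive x

  representative≡⇒σ≡ : ∀ {x y} → col x ≢ col y →
    representative x ≡ representative y → σ x ≡ y
  representative≡⇒σ≡ {x} {y} x≢y rx≡ry = Injection.injective (↔⇒↣ ↔representative×Bool)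
    (cong₂ _,_ (trans (representative-σ x) rx≡ry) (trans (col-σ x) (sym (¬-not (≢-sym x≢y)))))

module _ (G : Graph) where

  private
    V = Fin (n G)

  CommonNbr : V → V → Set
  CommonNbr x y = ∃[ z ] inClosedNbr G x z × inClosedNbr G y z

  inClosedNbr-sym : ∀ {x y} → inClosedNbr G x y → inClosedNbr G y x
  inClosedNbr-sym (inj₁ refl) = inj₁ refl
  inClosedNbr-sym {x} {y} (inj₂ xy) = inj₂ (trans (Graph.sym G y x) xy)

  reach-suc⇒ : ∀ k {x y} → reach G (suc k) x y ≡ true →
    reach G k x y ≡ true ⊎ ∃[ z ] adj G x z ≡ true × reach G k z y ≡ true
  reach-suc⇒ k {x} {y} r with reach G k x y
  ... | true  = inj₁ refl
  ... | false with any⇒∃ _ (allFin (n G)) r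
  ...   | z , xz∧zy = inj₂ (z , ∧≡true⇒ xz∧zy)

  reach-step : ∀ k {x z y} → adj G x z ≡ true → reach G k z y ≡ true → reach G (suc k) x y ≡ true
  reach-step k {x} {z} {y} xz zy = trans
    (cong (reach G k x y ∨_) (∃⇒any (λ w → adj G x w ∧ reach G k w y) (∈-allFin z)
                                    (trans (cong (_∧ reach G k z y) xz) zy)))
    (∨-zeroʳ (reach G k x y))

  reach-suc : ∀ k {x y} → reach G k x y ≡ true → reach G (suc k) x y ≡ true
  reach-suc k r rewrite r = refl

  reach-refl : ∀ k x → reach G k x x ≡ true
  reach-refl zero    x with x ≟ x
  ... | yes _  = refl
  ... | no x≢x = contradiction refl x≢x
  reach-refl (suc k) x = reach-suc k (reach-refl k x)

  reach0⇒≡ : ∀ {x y} → reach G 0 x y ≡ true → x ≡ y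
  reach0⇒≡ {x} {y} r with x ≟ y
  ... | yes x≡y = x≡y

  reach1⇒inClosedNbr : ∀ {x y} → reach G 1 x y ≡ true → inClosedNbr G x y
  reach1⇒inClosedNbr r with reach-suc⇒ 0 r
  ... | inj₁ r₀ = inj₁ (reach0⇒≡ r₀)
  ... | inj₂ (z , xz , r₀) with reach0⇒≡ r₀
  ...   | refl = inj₂ xz

  inClosedNbr⇒reach1 : ∀ {x y} → inClosedNbr G x y → reach G 1 x y ≡ true
  inClosedNbr⇒reach1 (inj₁ refl) = reach-refl 1 _
  inClosedNbr⇒reach1 (inj₂ xy)   = reach-step 0 xy (reach-refl 0 _)

  reach2⇒CommonNbr : ∀ {x y} → reach G 2 x y ≡ true → CommonNbr x y
  reach2⇒CommonNbr {y = y} r with reach-suc⇒ 1 r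
  ... | inj₁ r₁ = y , reach1⇒inClosedNbr r₁ , inj₁ refl
  ... | inj₂ (z , xz , r₁) = z , inj₂ xz , inClosedNbr-sym (reach1⇒inClosedNbr r₁)

  CommonNbr⇒reach2 : ∀ {x y} → CommonNbr x y → reach G 2 x y ≡ true
  CommonNbr⇒reach2 (z , inj₁ refl , yz) = reach-suc 1 (inClosedNbr⇒reach1 (inClosedNbr-sym yz))
  CommonNbr⇒reach2 (z , inj₂ xz  , yz) = reach-step 1 xz (inClosedNbr⇒reach1 (inClosedNbr-sym yz))

  adj⇒≢ : ∀ {x y} → adj G x y ≡ true → x ≢ y
  adj⇒≢ {x} xy refl with () ← trans (sym xy) (irrefl G x)

  adj∧atDist1≡adj : ∀ x z → adj G x z ∧ atDist G 1 z x ≡ adj G x z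
  adj∧atDist1≡adj x z with adj G x z in xz
  ... | false = refl
  ... | true = cong₂ (λ r₁ r₀ → r₁ ∧ not r₀)
    (inClosedNbr⇒reach1 (inj₂ (trans (Graph.sym G z x) xz)))
    (⌊≟⌋≡false (λ z≡x → adj⇒≢ xz (sym z≡x)))

  DistanceRegular⇒regular : DistanceRegular G → ∀ x y → countᶠ (adj G x) ≡ countᶠ (adj G y)
  DistanceRegular⇒regular dr x y = begin
    countᶠ (adj G x)  ≡⟨ degree≡bNum0 x ⟩
    bNum G 0 x x      ≡⟨ proj₁ (dr 0 x x y y (reach-refl 0 x) (reach-refl 0 y)) ⟩
    bNum G 0 y y      ≡⟨ degree≡bNum0 y ⟨
    countᶠ (adj G y)  ∎
    where
    open ≡-Reasoning
    degree≡bNum0 : ∀ x → countᶠ (adj G x) ≡ bNum G 0 x x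
    degree≡bNum0 x = trans (sym (countᶠ-cong (adj∧atDist1≡adj x))) (sym (count≡countᶠ G _))

  atDist-suc⇒¬reach : ∀ k {x y} → atDist G (suc k) x y ≡ true → reach G k x y ≡ false
  atDist-suc⇒¬reach k {x} {y} d with reach G k x y
  atDist-suc⇒¬reach k _  | false = refl
  atDist-suc⇒¬reach k () | true

  reach∧¬reach⇒atDist-suc : ∀ k {x y} → reach G (suc k) x y ≡ true → reach G k x y ≡ false →
    atDist G (suc k) x y ≡ true
  reach∧¬reach⇒atDist-suc k r ¬r = cong₂ (λ a b → a ∧ not b) r ¬r

  ¬CommonNbr⇒reach2≡false : ∀ {x y} → ¬ CommonNbr x y → reach G 2 x y ≡ false
  ¬CommonNbr⇒reach2≡false {x} {y} disjoint with reach G 2 x y in r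
  ... | false = refl
  ... | true  = contradiction (reach2⇒CommonNbr r) disjoint

  ¬CommonNbr⇒adj≡false : ∀ {x y} → ¬ CommonNbr x y → adj G x y ≡ false
  ¬CommonNbr⇒adj≡false {x} {y} disjoint with adj G x y in xy
  ... | false = refl
  ... | true  = contradiction (y , inj₂ xy , inj₁ refl) disjoint

  atDist3⇒¬CommonNbr : ∀ {x y} → atDist G 3 x y ≡ true → ¬ CommonNbr x y
  atDist3⇒¬CommonNbr d common
    with () ← trans (sym (CommonNbr⇒reach2 common)) (atDist-suc⇒¬reach 2 d)

-- In K_{m,m} minus a perfect matching the antipode of x is its partner in the matching.
IsAntipode : (G : Graph) → (Fin (n G) → Bool) → Fin (n G) → Fin (n G) → Set
IsAntipode G col x z = col x ≢ col z × adj G x z ≡ false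

module _ (G : Graph) (bip : Bipartite G) (reach3 : ∀ x y → reach G 3 x y ≡ true) where

  private
    V = Fin (n G)
    col = proj₁ bip
    adj⇒≢col = proj₂ bip

  sameColour⇒CommonNbr : ∀ {x y} → col x ≡ col y → CommonNbr G x y
  sameColour⇒CommonNbr {x} {y} x≡y with reach-suc⇒ G 2 (reach3 x y)
  ... | inj₁ r₂ = reach2⇒CommonNbr G r₂
  ... | inj₂ (w , xw , r₂) with reach2⇒CommonNbr G r₂
  ...   | z , inj₁ refl , inj₁ refl = contradiction x≡y (adj⇒≢col x y xw)
  ...   | z , inj₁ refl , inj₂ yw   = w , inj₂ xw , inj₂ yw
  ...   | z , inj₂ wz   , inj₁ refl = w , inj₂ xw , inj₂ (trans (Graph.sym G y w) wz)
  ...   | z , inj₂ wz   , inj₂ yz   =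
    contradiction (trans (sym x≡y) (≢-≢⇒≡ (adj⇒≢col x w xw) (adj⇒≢col w z wz)))
                  (adj⇒≢col y z yz)

  module _ {C : V → Bool} (code : Perfect1Code G C) where

    codewords-≡ : ∀ {c c′ z} → C c ≡ true → C c′ ≡ true →
      inClosedNbr G c z → inClosedNbr G c′ z → c ≡ c′
    codewords-≡ Cc Cc′ = proj₂ (code _) _ _ Cc Cc′

    sameColour-codewords-≡ : ∀ {c c′} → C c ≡ true → C c′ ≡ true →
      col c ≡ col c′ → c ≡ c′
    sameColour-codewords-≡ Cc Cc′ c≡c′ with sameColour⇒CommonNbr c≡c′
    ... | _ , cz , c′z = codewords-≡ Cc Cc′ cz c′z

    module CodewordPair {u v} (Cu : C u ≡ true) (Cv : C v ≡ true) (u≢v : col u ≢ col v) where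

      codeword⇒≡u⊎≡v : ∀ {w} → C w ≡ true → w ≡ u ⊎ w ≡ v
      codeword⇒≡u⊎≡v {w} Cw with col w ≟ᵇ col u
      ... | yes w≡u = inj₁ (sameColour-codewords-≡ Cw Cu w≡u)
      ... | no  w≢u = inj₂ (sameColour-codewords-≡ Cw Cv (≢-≢⇒≡ w≢u u≢v))

      codewords⇔ : ∀ w → (C w ≡ true) ⇔ (w ≡ u ⊎ w ≡ v)
      codewords⇔ w = mk⇔ codeword⇒≡u⊎≡v λ { (inj₁ refl) → Cu ; (inj₂ refl) → Cv }

      codewords-atDist3 : atDist G 3 u v ≡ true
      codewords-atDist3 = reach∧¬reach⇒atDist-suc G 2 (reach3 u v) (¬CommonNbr⇒reach2≡false G
        λ (_ , uz , vz) → u≢v (cong col (codewords-≡ Cu Cv uz vz)))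

      codewords-nonadjacent : adj G u v ≡ false
      codewords-nonadjacent with adj G u v in uv
      ... | false = refl
      ... | true  = contradiction (cong col (codewords-≡ Cu Cv (inj₂ uv) (inj₁ refl))) u≢v

      adj-other-codeword : ∀ {w} → col w ≡ col u → w ≢ u → adj G v w ≡ true
      adj-other-codeword {w} w≡u w≢u with proj₁ (code w)
      ... | c , Cc , cw with codeword⇒≡u⊎≡v Cc | cw
      ...   | inj₁ refl | inj₁ refl = contradiction refl w≢u
      ...   | inj₁ refl | inj₂ uw   = contradiction (sym w≡u) (adj⇒≢col u w uw)
      ...   | inj₂ refl | inj₁ refl = contradiction (sym w≡u) u≢v
      ...   | inj₂ refl | inj₂ vw   = vw

    open CodewordPair

    codeword-antipode-∃! : ∀ {u v} → C u ≡ true → C v ≡ true → col u ≢ col v →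
      ∃! _≡_ (IsAntipode G col u)
    codeword-antipode-∃! {u} {v} Cu Cv u≢v = v , (u≢v , codewords-nonadjacent Cu Cv u≢v) , only-v
      where
      vClass⇒adj-u : ∀ {z} → col z ≡ col v → z ≢ v → adj G u z ≡ true
      vClass⇒adj-u = adj-other-codeword Cv Cu (≢-sym u≢v)

      only-v : ∀ {z} → IsAntipode G col u z → v ≡ z
      only-v {z} (u≢z , uz) with z ≟ v
      ... | yes z≡v = sym z≡v
      ... | no  z≢v with () ← trans (sym (vClass⇒adj-u (≢-≢⇒≡ (≢-sym u≢z) u≢v) z≢v)) uz

    -- N(x) ∖ {v} ⊆ N(u) and |N(x)| = |N(u)|, so N(u) ∖ N(x) is a single vertex, the antipode of x.
    antipode-∃! : (∀ x y → countᶠ (adj G x) ≡ countᶠ (adj G y)) →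
      ∀ {u v} → C u ≡ true → C v ≡ true → col u ≢ col v →
      ∀ {x} → col x ≡ col u → x ≢ u → ∃! _≡_ (IsAntipode G col x)
    antipode-∃! regular {u} {v} Cu Cv u≢v {x} x≡u x≢u =
      ∃!-⇔ antipode⇔ (countᶠ-⊆-suc⇒∃! p (adj G u) p⊆Nu #Nu≡1+#p)
      where
      p : V → Bool
      p z = adj G x z ∧ not ⌊ z ≟ v ⌋

      vClass⇒adj-u : ∀ {z} → col z ≡ col v → z ≢ v → adj G u z ≡ true
      vClass⇒adj-u = adj-other-codeword Cv Cu (≢-sym u≢v)

      xv : adj G x v ≡ true
      xv = trans (Graph.sym G x v) (adj-other-codeword Cu Cv u≢v x≡u x≢u)

      #Nu≡1+#p : countᶠ (adj G u) ≡ suc (countᶠ p)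
      #Nu≡1+#p = trans (regular u x) (countᶠ-remove (adj G x) xv)

      p⊆Nu : ∀ z → p z ≡ true → adj G u z ≡ true
      p⊆Nu z pz with ∧≡true⇒ pz
      ... | xz , z≢v =
        vClass⇒adj-u (≢-≢⇒≡ (λ z≡u → adj⇒≢col x z xz (trans x≡u (sym z≡u))) u≢v)
                     (not⌊≟⌋≡true⇒≢ z≢v)

      nonadjacent : ∀ {z} → adj G u z ≡ true → not (p z) ≡ true → adj G x z ≡ false
      nonadjacent {z} uz ¬pz with z ≟ v | adj G x z
      ... | yes refl | _ with () ← trans (sym uz) (codewords-nonadjacent Cu Cv u≢v)
      nonadjacent uz ¬pz | no _ | false = refl
      nonadjacent uz ()  | no _ | true

      antipode⇔ : ∀ z → (adj G u z ∧ not (p z) ≡ true) ⇔ IsAntipode G col x z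
      antipode⇔ z = mk⇔ to from
        where
        to : adj G u z ∧ not (p z) ≡ true → IsAntipode G col x z
        to uz∧¬pz = (λ x≡z → adj⇒≢col u z uz (trans (sym x≡u) x≡z)) , nonadjacent uz ¬pz
          where
          uz : adj G u z ≡ true
          uz = proj₁ (∧≡true⇒ uz∧¬pz)
          ¬pz : not (p z) ≡ true
          ¬pz = proj₂ (∧≡true⇒ uz∧¬pz)
        from : IsAntipode G col x z → adj G u z ∧ not (p z) ≡ true
        from (x≢z , xz) = cong₂ (λ a b → a ∧ not b) uz (cong (_∧ not ⌊ z ≟ v ⌋) xz)
          where
          z≢v : z ≢ v
          z≢v refl with () ← trans (sym xz) xv
          uz : adj G u z ≡ true
          uz = vClass⇒adj-u (≢-≢⇒≡ (λ z≡u → x≢z (trans x≡u (sym z≡u))) u≢v) z≢v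

    module DiametralCodewords (regular : ∀ x y → countᶠ (adj G x) ≡ countᶠ (adj G y))
                              (x y : V) (xy : atDist G 3 x y ≡ true) where

      u v : V
      u = proj₁ (proj₁ (code x))
      v = proj₁ (proj₁ (code y))

      Cu : C u ≡ true
      Cu = proj₁ (proj₂ (proj₁ (code x)))
      Cv : C v ≡ true
      Cv = proj₁ (proj₂ (proj₁ (code y)))

      ux : inClosedNbr G u x
      ux = proj₂ (proj₂ (proj₁ (code x)))
      vy : inClosedNbr G v y
      vy = proj₂ (proj₂ (proj₁ (code y)))

      u≢v : col u ≢ col v
      u≢v u≡v = atDist3⇒¬CommonNbr G xy (u , inClosedNbr-sym G ux ,
        subst (inClosedNbr G y) (sym (sameColour-codewords-≡ Cu Cv u≡v)) (inClosedNbr-sym G vy))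

      open CodewordPair Cu Cv u≢v public using (codewords⇔; codewords-atDist3)

      antipodes : ∀ w → ∃! _≡_ (IsAntipode G col w)
      antipodes w with w ≟ u | w ≟ v | col w ≟ᵇ col u
      ... | yes refl | _        | _       = codeword-antipode-∃! Cu Cv u≢v
      ... | no  _    | yes refl | _       = codeword-antipode-∃! Cv Cu (≢-sym u≢v)
      ... | no  w≢u  | no  _    | yes w≡u =
        antipode-∃! regular Cu Cv u≢v w≡u w≢u
      ... | no  _    | no  w≢v  | no  w≢u =
        antipode-∃! regular Cv Cu (≢-sym u≢v) (≢-≢⇒≡ w≢u u≢v) w≢v

module AntipodalBipartite (G : Graph) (bip : Bipartite G)
                          (antipode : ∀ x → ∃! _≡_ (IsAntipode G (proj₁ bip) x)) where

  private
    V = Fin (n G)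
    col = proj₁ bip
    adj⇒≢col = proj₂ bip

  σ : V → V
  σ x = proj₁ (antipode x)

  σ-antipode : ∀ x → IsAntipode G col x (σ x)
  σ-antipode x = proj₁ (proj₂ (antipode x))

  σ-unique : ∀ {x z} → IsAntipode G col x z → σ x ≡ z
  σ-unique {x} = proj₂ (proj₂ (antipode x))

  IsAntipode-sym : ∀ {x z} → IsAntipode G col x z → IsAntipode G col z x
  IsAntipode-sym {x} {z} (x≢z , xz) = ≢-sym x≢z , trans (Graph.sym G z x) xz

  σ-involutive : ∀ x → σ (σ x) ≡ x
  σ-involutive x = σ-unique (IsAntipode-sym (σ-antipode x))

  col-σ : ∀ x → col (σ x) ≡ not (col x)
  col-σ x = ¬-not (≢-sym (proj₁ (σ-antipode x)))

  m : ℕ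
  m = countᶠ col

  ↔Fin×Bool : V ↔ (Fin m × Bool)
  ↔Fin×Bool = (enumerate col ×-↔ ↔-id Bool) ↔-∘ ↔representative×Bool col σ σ-involutive col-σ

  private
    index : V → Fin m
    index x = proj₁ (Inverse.to ↔Fin×Bool x)

    index≡⇒σ≡ : ∀ {x y} → col x ≢ col y → index x ≡ index y → σ x ≡ y
    index≡⇒σ≡ x≢y = representative≡⇒σ≡ col σ σ-involutive col-σ x≢y
                  ∘ Injection.injective (↔⇒↣ (enumerate col))

    index-σ : ∀ x → index (σ x) ≡ index x
    index-σ x = cong (Inverse.to (enumerate col)) (representative-σ col σ σ-involutive col-σ x)

  isKmmMinusMatching : IsKmmMinusMatching G m ↔Fin×Bool
  isKmmMinusMatching x y = mk⇔ to from
    where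
    to : adj G x y ≡ true → col x ≢ col y × index x ≢ index y
    to xy = x≢y , σx≢y ∘ index≡⇒σ≡ x≢y
      where
      x≢y : col x ≢ col y
      x≢y = adj⇒≢col x y xy
      σx≢y : σ x ≢ y
      σx≢y refl with () ← trans (sym xy) (proj₂ (σ-antipode x))
    from : col x ≢ col y × index x ≢ index y → adj G x y ≡ true
    from (x≢y , ix≢iy) with adj G x y in xy
    ... | true  = refl
    ... | false = contradiction (trans (sym (index-σ x)) (cong index (σ-unique (x≢y , xy))))
                                ix≢iy

module _ (G : Graph) where

  private
    V = Fin (n G)

  pair-Perfect1Code : ∀ {C u v} → (∀ w → (C w ≡ true) ⇔ (w ≡ u ⊎ w ≡ v)) → ¬ CommonNbr G u v →
    (∀ w → inClosedNbr G u w ⊎ inClosedNbr G v w) → Perfect1Code G C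
  pair-Perfect1Code {C} {u} {v} C⇔ disjoint cover w = covered (cover w) , unique
    where
    covered : inClosedNbr G u w ⊎ inClosedNbr G v w →
      Σ V λ c → C c ≡ true × inClosedNbr G c w
    covered (inj₁ uw) = u , Equivalence.from (C⇔ u) (inj₁ refl) , uw
    covered (inj₂ vw) = v , Equivalence.from (C⇔ v) (inj₂ refl) , vw
    unique : ∀ c c′ → C c ≡ true → C c′ ≡ true →
      inClosedNbr G c w → inClosedNbr G c′ w → c ≡ c′
    unique c c′ Cc Cc′ cw c′w with Equivalence.to (C⇔ c) Cc | Equivalence.to (C⇔ c′) Cc′
    ... | inj₁ refl | inj₁ refl = refl
    ... | inj₂ refl | inj₂ refl = refl
    ... | inj₁ refl | inj₂ refl = contradiction (w , cw , c′w) disjoint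
    ... | inj₂ refl | inj₁ refl = contradiction (w , c′w , cw) disjoint

  module _ {m} (f : V ↔ (Fin m × Bool)) (kmm : IsKmmMinusMatching G m f) where

    private
      index : V → Fin m
      index x = proj₁ (Inverse.to f x)
      side : V → Bool
      side x = proj₂ (Inverse.to f x)

    adj-across : ∀ {x y w} → side x ≢ side w → index x ≡ index y → side w ≡ side y → w ≢ y →
      adj G x w ≡ true
    adj-across {x} {y} {w} x≢w ix≡iy w≡y w≢y = Equivalence.from (kmm x w)
      (x≢w , λ ix≡iw → w≢y (Injection.injective (↔⇒↣ f)
                                           (cong₂ _,_ (trans (sym ix≡iw) ix≡iy) w≡y)))

    nonadjacent-across⇒index≡ : ∀ {u v} → adj G u v ≡ false → side u ≢ side v →
      index u ≡ index v
    nonadjacent-across⇒index≡ {u} {v} uv u≢v with index u ≟ index v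
    ... | yes iu≡iv = iu≡iv
    ... | no  iu≢iv with () ← trans (sym (Equivalence.from (kmm u v) (u≢v , iu≢iv))) uv

    nonadjacent-across⇒cover : ∀ {u v} → adj G u v ≡ false → side u ≢ side v →
      ∀ w → inClosedNbr G u w ⊎ inClosedNbr G v w
    nonadjacent-across⇒cover {u} {v} uv u≢v = cover (nonadjacent-across⇒index≡ uv u≢v)
      where
      cover : index u ≡ index v → ∀ w → inClosedNbr G u w ⊎ inClosedNbr G v w
      cover iu≡iv w with w ≟ u | w ≟ v | side w ≟ᵇ side u
      ... | yes refl | _        | _        = inj₁ (inj₁ refl)
      ... | no  _    | yes refl | _        = inj₂ (inj₁ refl)
      ... | no  w≢u  | no  _    | yes w≡u  =
        inj₂ (inj₂ (adj-across (λ v≡w → u≢v (sym (trans v≡w w≡u))) (sym iu≡iv) w≡u w≢u))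
      ... | no  _    | no  w≢v  | no  w≢u′ =
        inj₁ (inj₂ (adj-across (≢-sym w≢u′) iu≡iv (≢-≢⇒≡ w≢u′ u≢v) w≢v))

proposition5p1 : (G : Graph) → DistanceRegular G → Bipartite G → HasDiameter G 3 →
    (C : Fin (n G) → Bool) →
    Perfect1Code G C ⇔
      (Σ ℕ λ m → Σ (Fin (n G) ↔ (Fin m × Bool)) λ f → IsKmmMinusMatching G m f ×
        (Σ (Fin (n G)) λ u → Σ (Fin (n G)) λ v →
          (atDist G 3 u v ≡ true) ×
          (proj₂ (Inverse.to f u) ≢ proj₂ (Inverse.to f v)) ×
          (∀ w → (C w ≡ true) ⇔ ((w ≡ u) ⊎ (w ≡ v)))))
proposition5p1 G dr bip (reach3 , x , y , xy) C = mk⇔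
  (λ code → let open DiametralCodewords G bip reach3 code (DistanceRegular⇒regular G dr) x y xy
                open AntipodalBipartite G bip antipodes
            in m , ↔Fin×Bool , isKmmMinusMatching , u , v , codewords-atDist3 , u≢v , codewords⇔)
  (λ (m , f , kmm , u , v , uv , u≢v , C⇔) →
     let disjoint = atDist3⇒¬CommonNbr G uv
     in pair-Perfect1Code G C⇔ disjoint
          (nonadjacent-across⇒cover G f kmm (¬CommonNbr⇒adj≡false G disjoint) u≢v))
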